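{- Let $x$ be a uniformly recurrent infinite word. Then exactly one of the following holds: (1) for every $k\in\mathbb{N}$, $\underline{d}(AP(x,k))\geq \frac{2}{2+k(k-1)}$, and in this case $x$ is aperiodic; (2) there exists $r>0$ such that for every $k\in\mathbb{N}$, $\underline{d}(P(x,k))\geq r$, and in this case $x$ is purely periodic.
   Context: $\mathbb{N}=\{1,2,3,\ldots\}$. A $k$-power is $u^k$ for a non-empty word $u$; a $k$-anti-power is $u_1\cdots u_k$ with $u_1,\ldots,u_k$ non-empty, of equal length and pairwise distinct. For an infinite word $x$ and $k\in\mathbb{N}$: $P(x,k)=\{m\in\mathbb{N}: \text{the prefix of } x \text{ of length } km \text{ is a } k\text{ -power}\}$ and $AP(x,k)=\{m\in\mathbb{N}: \text{the prefix of } x \text{ of length } km \text{ is a } k\text{ -anti-power}\}$. For $X\subseteq\mathbb{N}$, $\underline{d}(X)=\liminf_{n\to\infty}|X\cap\{1,\ldots,n\}|/n$. An infinite word is uniformly recurrent if every finite factor occurs infinitely often with bounded gaps; purely periodic if it equals $u^\omega=uuu\cdots$ for some finite non-empty $u$; ultimately periodic if it is $v y$ with $v$ finite and $y$ purely periodic; aperiodic if not ultimately periodic. -}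

module Defs where

open import Data.Nat using (ℕ; zero; suc; _+_; _*_; _∸_; _≤_)
open import Data.Integer using (+_)
open import Data.Rational using (ℚ; _/_; _-_; _<_) renaming (_≤_ to _≤ℚ_; 0ℚ to 0ℚ)
open import Data.List using (List; []; _∷_; map; upTo; length; concat; replicate; _++_)
open import Data.List.Relation.Unary.All using (All)
open import Data.List.Relation.Unary.Unique.Propositional using (Unique)
open import Data.Product using (Σ; ∃; _×_; _,_)
open import Data.Sum using (_⊎_)
open import Relation.Binary.PropositionalEquality using (_≡_; _≢_)
open import Relation.Nullary using (¬_)

-- Infinite words over an alphabet A, indexed from position 0.
Word : Set → Set
Word A = ℕ → A

prefix : {A : Set} → ℕ → Word A → List A
prefix n x = map x (upTo n)

factor : {A : Set} → Word A → ℕ → ℕ → List A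
factor x i L = map (λ j → x (i + j)) (upTo L)

IsPower : {A : Set} → ℕ → List A → Set
IsPower {A} k w = Σ (List A) λ u → (u ≢ []) × (w ≡ concat (replicate k u))

IsAntiPower : {A : Set} → ℕ → List A → Set
IsAntiPower {A} k w =
  Σ (List (List A)) λ us → Σ ℕ λ ℓ →
      (length us ≡ k)
    × All (λ u → u ≢ []) us
    × All (λ u → length u ≡ ℓ) us
    × Unique us
    × (w ≡ concat us)

-- P(x,k) and AP(x,k) as predicates on ℕ = {1,2,...} (m ≥ 1 required)
P : {A : Set} → Word A → ℕ → ℕ → Set
P x k m = (1 ≤ m) × IsPower k (prefix (k * m) x)

AP : {A : Set} → Word A → ℕ → ℕ → Set
AP x k m = (1 ≤ m) × IsAntiPower k (prefix (k * m) x)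

-- |X ∩ {1,…,n}| ≥ c : there are c distinct elements of X in {1,…,n}
CountAtLeast : (ℕ → Set) → ℕ → ℕ → Set
CountAtLeast X n c =
  Σ (List ℕ) λ l → Unique l × (length l ≡ c) × All (λ i → (1 ≤ i) × (i ≤ n) × X i) l

LowerDensity≥ : (ℕ → Set) → ℚ → Set
LowerDensity≥ X c =
  (ε : ℚ) → 0ℚ < ε →
  Σ ℕ λ N → (n : ℕ) → N ≤ suc n →
  Σ ℕ λ m → CountAtLeast X (suc n) m × ((c - ε) ≤ℚ ((+ m) / suc n))

UniformlyRecurrent : {A : Set} → Word A → Set
UniformlyRecurrent x =
  (i L : ℕ) → Σ ℕ λ B → (j : ℕ) →
  Σ ℕ λ p → (j ≤ p) × (p ≤ j + B) × (factor x p L ≡ factor x i L)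

PurelyPeriodic : {A : Set} → Word A → Set
PurelyPeriodic {A} x =
  Σ (List A) λ u → (u ≢ []) × ((n : ℕ) → prefix (n * length u) x ≡ concat (replicate n u))

_++ω_ : {A : Set} → List A → Word A → Word A
[] ++ω y = y
(a ∷ v) ++ω y = λ { zero → a ; (suc n) → (v ++ω y) n }

UltimatelyPeriodic : {A : Set} → Word A → Set
UltimatelyPeriodic {A} x =
  Σ (List A) λ v → Σ (Word A) λ y → PurelyPeriodic y × ((n : ℕ) → x n ≡ (v ++ω y) n)

Aperiodic : {A : Set} → Word A → Set
Aperiodic x = ¬ UltimatelyPeriodic x

antiPowerBound : ℕ → ℚ
antiPowerBound k = (+ 2) / (2 + k * (k ∸ 1))

-- condition (1) and condition (2) (ℕ = {1,2,...}, so k ≥ 1)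
Cond1 : {A : Set} → Word A → Set
Cond1 x = (k : ℕ) → 1 ≤ k → LowerDensity≥ (AP x k) (antiPowerBound k)

Cond2 : {A : Set} → Word A → Set
Cond2 x = Σ ℚ λ r → (0ℚ < r) × ((k : ℕ) → 1 ≤ k → LowerDensity≥ (P x k) r)

-- If x is ultimately periodic, uniform recurrence makes it purely periodic, say with period p.
-- Then every prefix whose length is a multiple of p is a k-power for every k, so P(x, k) meets every
-- window of length p, while blocks 0 and p of any prefix of length (p + 1)m coincide, so
-- AP(x, p + 1) is empty.
--
-- If x is aperiodic, uniform recurrence gives, for every P, a length L such that no factor of
-- length L has a period in [1, P]. Squares of lengths 2m and 2(m + s) with L ≤ m and s ≤ P would
-- give the factor of length L at m the period s, so beyond L the set P(x, 2) has gaps larger than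
-- P and its lower density is 0. Similarly, among any k(k − 1)/2 + 1 consecutive large m, some
-- prefix of length km is a k-anti-power: otherwise two of these m repeat the same pair of equal
-- blocks, which again forces a short period on a long factor. Bounded gaps of length k(k − 1)/2
-- give the lower density 2/(2 + k(k − 1)).

module Submission where

open import Defs
open import Axiom.ExcludedMiddle using (ExcludedMiddle)
open import Axiom.DoubleNegationElimination using (DoubleNegationElimination; em⇒dne)
open import Level using (0ℓ)
open import Data.Nat using (ℕ; zero; suc; _+_; _*_; _∸_; _≤_; _<_; z≤n; s≤s; z<s; s<s; s<s⁻¹; s≤s⁻¹; NonZero; _<?_; _≤?_; _/_; _%_)
open import Data.Nat.Properties
open import Algebra.Properties.CommutativeSemigroup +-commutativeSemigroup using (x∙yz≈xz∙y; xy∙z≈xz∙y)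
open import Data.Nat.DivMod using (m≡m%n+[m/n]*n; m%n<n; m/n*n≤m; /-monoˡ-≤)
open import Data.Nat.Tactic.RingSolver using (solve-∀)
import Data.Integer as ℤ
import Data.Integer.Properties as ℤP
import Data.Integer.Tactic.RingSolver as ℤSolver
open import Data.Rational using (ℚ; 0ℚ)
import Data.Rational as ℚ
import Data.Rational.Properties as ℚP
import Data.Rational.Unnormalised as ℚᵘ
import Data.Rational.Unnormalised.Properties as ℚᵘP
open import Data.List using (List; []; _∷_; upTo; applyUpTo; length; lookup; concat; replicate; _++_)
open import Data.List.Properties using (map-upTo; length-map; length-upTo; length-++; length-applyUpTo; ∷-injectiveˡ; ∷-injectiveʳ)
open import Data.List.Membership.Propositional.Properties using (∈-lookup)
open import Data.List.Relation.Unary.All as All using (All; []; _∷_)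
open import Data.List.Relation.Unary.All.Properties using (applyUpTo⁺₁; applyUpTo⁻)
open import Data.List.Relation.Unary.AllPairs using ([]; _∷_)
open import Data.List.Relation.Unary.Unique.Propositional using (Unique)
import Data.List.Relation.Unary.Unique.Propositional.Properties as Unique
open import Data.Fin using (Fin; toℕ; fromℕ<)
import Data.Fin as Fin
open import Data.Fin.Properties using (pigeonhole; toℕ-fromℕ<; toℕ≤pred[n])
open import Data.Product using (Σ; ∃; ∃₂; _×_; _,_; proj₁; proj₂; map₂)
open import Data.Sum using (_⊎_; inj₁; inj₂)
open import Data.Empty using (⊥; ⊥-elim)
open import Function using (_∘_)
open import Relation.Nullary using (¬_; yes; no)
open import Relation.Binary.Definitions using (tri<; tri≈; tri>)
open import Relation.Binary.PropositionalEquality using (_≡_; _≢_; refl; sym; trans; cong; cong₂; subst; subst₂; module ≡-Reasoning)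

-- Factors and periods

module _ {B : Set} where

  applyUpTo-cong : ∀ (f g : ℕ → B) n → (∀ {t} → t < n → f t ≡ g t) → applyUpTo f n ≡ applyUpTo g n
  applyUpTo-cong f g zero    f≡g = refl
  applyUpTo-cong f g (suc n) f≡g = cong₂ _∷_ (f≡g z<s) (applyUpTo-cong (f ∘ suc) (g ∘ suc) n (f≡g ∘ s<s))

  applyUpTo-cong⁻ : ∀ (f g : ℕ → B) n → applyUpTo f n ≡ applyUpTo g n → ∀ {t} → t < n → f t ≡ g t
  applyUpTo-cong⁻ f g (suc n) eq {zero}  _   = ∷-injectiveˡ eq
  applyUpTo-cong⁻ f g (suc n) eq {suc t} t<n = applyUpTo-cong⁻ (f ∘ suc) (g ∘ suc) n (∷-injectiveʳ eq) (s<s⁻¹ t<n)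

  applyUpTo-++ : ∀ (f : ℕ → B) a b → applyUpTo f (a + b) ≡ applyUpTo f a ++ applyUpTo (λ t → f (a + t)) b
  applyUpTo-++ f zero    b = refl
  applyUpTo-++ f (suc a) b = cong (f 0 ∷_) (applyUpTo-++ (f ∘ suc) a b)

  ++-injective : ∀ (xs xs′ ys ys′ : List B) → length xs ≡ length xs′ →
                 xs ++ ys ≡ xs′ ++ ys′ → xs ≡ xs′ × ys ≡ ys′
  ++-injective []       []        ys ys′ _   eq = refl , eq
  ++-injective (a ∷ xs) (a′ ∷ xs′) ys ys′ len eq
    with ++-injective xs xs′ ys ys′ (suc-injective len) (∷-injectiveʳ eq)
  ... | xs≡xs′ , ys≡ys′ = cong₂ _∷_ (∷-injectiveˡ eq) xs≡xs′ , ys≡ys′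

  length-concat-uniform : ∀ ℓ (us : List (List B)) → All (λ u → length u ≡ ℓ) us →
                          length (concat us) ≡ length us * ℓ
  length-concat-uniform ℓ []       []         = refl
  length-concat-uniform ℓ (u ∷ us) (lu ∷ lus) =
    trans (length-++ u) (cong₂ _+_ lu (length-concat-uniform ℓ us lus))

++ω-shift : ∀ {A : Set} (v : List A) (y : Word A) t → (v ++ω y) (length v + t) ≡ y t
++ω-shift []      y t = refl
++ω-shift (a ∷ v) y t = ++ω-shift v y t

module _ {A : Set} (x : Word A) where

  length-factor : ∀ i L → length (factor x i L) ≡ L
  length-factor i L = trans (length-map _ (upTo L)) (length-upTo L)

  factor-≡⁺ : ∀ i j L → (∀ {t} → t < L → x (i + t) ≡ x (j + t)) → factor x i L ≡ factor x j L
  factor-≡⁺ i j L eq = trans (map-upTo _ L) (trans (applyUpTo-cong _ _ L eq) (sym (map-upTo _ L)))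

  factor-≡⁻ : ∀ i j L → factor x i L ≡ factor x j L → ∀ {t} → t < L → x (i + t) ≡ x (j + t)
  factor-≡⁻ i j L eq = applyUpTo-cong⁻ _ _ L (trans (sym (map-upTo _ L)) (trans eq (map-upTo _ L)))

  factor-++ : ∀ i a b → factor x i (a + b) ≡ factor x i a ++ factor x (i + a) b
  factor-++ i a b = begin
    factor x i (a + b)
      ≡⟨ map-upTo _ (a + b) ⟩
    applyUpTo (λ t → x (i + t)) (a + b)
      ≡⟨ applyUpTo-++ _ a b ⟩
    applyUpTo (λ t → x (i + t)) a ++ applyUpTo (λ t → x (i + (a + t))) b
      ≡⟨ cong₂ _++_ (sym (map-upTo _ a))
                    (applyUpTo-cong _ _ b (λ {t} _ → cong x (sym (+-assoc i a t)))) ⟩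
    factor x i a ++ applyUpTo (λ t → x (i + a + t)) b
      ≡⟨ cong (factor x i a ++_) (sym (map-upTo _ b)) ⟩
    factor x i a ++ factor x (i + a) b ∎
    where open ≡-Reasoning

  factor-restrict : ∀ {i j L L′} → L ≤ L′ → factor x i L′ ≡ factor x j L′ → factor x i L ≡ factor x j L
  factor-restrict {i} {j} {L} {L′} L≤L′ eq =
    factor-≡⁺ i j L (λ t<L → factor-≡⁻ i j L′ eq (≤-trans t<L L≤L′))

  factor-shift : ∀ {i j L L′} o → o + L ≤ L′ → factor x i L′ ≡ factor x j L′ →
                 factor x (i + o) L ≡ factor x (j + o) L
  factor-shift {i} {j} {L} {L′} o le eq = factor-≡⁺ (i + o) (j + o) L shifted
    where
    shifted : ∀ {t} → t < L → x (i + o + t) ≡ x (j + o + t)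
    shifted {t} t<L = begin
      x (i + o + t)   ≡⟨ cong x (+-assoc i o t) ⟩
      x (i + (o + t)) ≡⟨ factor-≡⁻ i j L′ eq (≤-trans (+-monoʳ-< o t<L) le) ⟩
      x (j + (o + t)) ≡⟨ cong x (sym (+-assoc j o t)) ⟩
      x (j + o + t)   ∎
      where open ≡-Reasoning

  concat-blocks : ∀ i m k → concat (applyUpTo (λ j → factor x (i + j * m) m) k) ≡ factor x i (k * m)
  concat-blocks i m zero    = refl
  concat-blocks i m (suc k) = begin
    factor x (i + 0) m ++ concat (applyUpTo (λ j → factor x (i + (m + j * m)) m) k)
      ≡⟨ cong₂ _++_ (cong (λ z → factor x z m) (+-identityʳ i))
                    (cong concat (applyUpTo-cong _ _ k (λ {j} _ → cong (λ z → factor x z m) (sym (+-assoc i m (j * m)))))) ⟩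
    factor x i m ++ concat (applyUpTo (λ j → factor x (i + m + j * m) m) k)
      ≡⟨ cong (factor x i m ++_) (concat-blocks (i + m) m k) ⟩
    factor x i m ++ factor x (i + m) (k * m)
      ≡⟨ sym (factor-++ i m (k * m)) ⟩
    factor x i (m + k * m) ∎
    where open ≡-Reasoning

  concat≡factor⇒blocks : ∀ i m (us : List (List A)) → All (λ u → length u ≡ m) us →
                         concat us ≡ factor x i (length us * m) →
                         us ≡ applyUpTo (λ j → factor x (i + j * m) m) (length us)
  concat≡factor⇒blocks i m []       []         _  = refl
  concat≡factor⇒blocks i m (u ∷ us) (lu ∷ lus) eq
    with ++-injective u (factor x i m) (concat us) (factor x (i + m) (length us * m))
                      (trans lu (sym (length-factor i m))) (trans eq (factor-++ i m _))
  ... | u≡ , us≡ = cong₂ _∷_ (trans u≡ (cong (λ z → factor x z m) (sym (+-identityʳ i))))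
                     (trans (concat≡factor⇒blocks (i + m) m us lus us≡)
                       (applyUpTo-cong _ _ (length us) (λ {j} _ → cong (λ z → factor x z m) (+-assoc i m (j * m)))))

  PeriodAt : ℕ → ℕ → ℕ → Set
  PeriodAt p a L = factor x a L ≡ factor x (a + p) L

  Periodic : ℕ → Set
  Periodic p = ∀ n → x (n + p) ≡ x n

  periodic-* : ∀ {p} → Periodic p → ∀ c → Periodic (c * p)
  periodic-*     per zero    n = cong x (+-identityʳ n)
  periodic-* {p} per (suc c) n = begin
    x (n + (p + c * p)) ≡⟨ cong x (x∙yz≈xz∙y n p (c * p)) ⟩
    x (n + c * p + p)   ≡⟨ per (n + c * p) ⟩
    x (n + c * p)       ≡⟨ periodic-* per c n ⟩
    x n                 ∎
    where open ≡-Reasoning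

  periodic⇒prefixPower : ∀ {p} → Periodic p → ∀ k → prefix (k * p) x ≡ concat (replicate k (prefix p x))
  periodic⇒prefixPower     per zero    = refl
  periodic⇒prefixPower {p} per (suc k) = begin
    factor x 0 (p + k * p)                       ≡⟨ factor-++ 0 p (k * p) ⟩
    prefix p x ++ factor x p (k * p)             ≡⟨ cong (prefix p x ++_) shifted ⟩
    prefix p x ++ prefix (k * p) x               ≡⟨ cong (prefix p x ++_) (periodic⇒prefixPower per k) ⟩
    prefix p x ++ concat (replicate k (prefix p x)) ∎
    where
    open ≡-Reasoning
    shifted : factor x p (k * p) ≡ factor x 0 (k * p)
    shifted = factor-≡⁺ p 0 (k * p) (λ {t} _ → trans (cong x (+-comm p t)) (per t))

  periodic⇒purelyPeriodic : ∀ p → Periodic (suc p) → PurelyPeriodic x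
  periodic⇒purelyPeriodic p per = prefix (suc p) x , (λ ()) , λ k →
    subst (λ ℓ → prefix (k * ℓ) x ≡ concat (replicate k (prefix (suc p) x)))
          (sym (length-factor 0 (suc p))) (periodic⇒prefixPower per k)

  purelyPeriodic⇒periodic : PurelyPeriodic x → ∃ λ p → Periodic (suc p)
  purelyPeriodic⇒periodic ([]     , u≢[] , _)   = ⊥-elim (u≢[] refl)
  purelyPeriodic⇒periodic (a ∷ u′ , _    , pow) = length u′ , periodic
    where
    p = suc (length u′)
    shifted : ∀ n → factor x p (n * p) ≡ factor x 0 (n * p)
    shifted n = trans (proj₂ (++-injective _ _ _ _ (length-factor 0 p)
                                (trans (sym (factor-++ 0 p (n * p))) (pow (suc n)))))
                      (sym (pow n))
    periodic : Periodic p
    periodic t = trans (cong x (+-comm t p)) (factor-≡⁻ p 0 (suc t * p) (shifted (suc t)) (m≤m*n (suc t) p))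

  recurrentPeriod⇒periodic : UniformlyRecurrent x → ∀ p → (∀ L → ∃ λ a → PeriodAt p a L) → Periodic p
  recurrentPeriod⇒periodic ur p periodAt q with ur q (suc p)
  ... | B , recurs with periodAt (suc B)
  ... | a , per with recurs a
  ... | r , a≤r , r≤a+B , occurrence = begin
    x (q + p) ≡⟨ sym (recur ≤-refl) ⟩
    x (r + p) ≡⟨ periodAtR ⟩
    x r       ≡⟨ cong x (sym (+-identityʳ r)) ⟩
    x (r + 0) ≡⟨ recur z<s ⟩
    x (q + 0) ≡⟨ cong x (+-identityʳ q) ⟩
    x q       ∎
    where
    open ≡-Reasoning
    recur : ∀ {t} → t < suc p → x (r + t) ≡ x (q + t)
    recur = factor-≡⁻ r q (suc p) occurrence
    a+[r∸a]≡r : a + (r ∸ a) ≡ r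
    a+[r∸a]≡r = m+[n∸m]≡n a≤r
    periodAtR : x (r + p) ≡ x r
    periodAtR = begin
      x (r + p)             ≡⟨ cong (λ z → x (z + p)) (sym a+[r∸a]≡r) ⟩
      x (a + (r ∸ a) + p)   ≡⟨ cong x (xy∙z≈xz∙y a (r ∸ a) p) ⟩
      x (a + p + (r ∸ a))   ≡⟨ sym (factor-≡⁻ a (a + p) (suc B) per (s≤s (m≤n+o⇒m∸n≤o r a r≤a+B))) ⟩
      x (a + (r ∸ a))       ≡⟨ cong x a+[r∸a]≡r ⟩
      x r                   ∎

  PeriodFree : ℕ → ℕ → Set
  PeriodFree P L = ∀ a {p} → 1 ≤ p → p ≤ P → ¬ PeriodAt p a L

module _ {A : Set} {x : Word A} (ur : UniformlyRecurrent x) where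

  ultimatelyPeriodic⇒periodic : UltimatelyPeriodic x → ∃ λ p → Periodic x (suc p)
  ultimatelyPeriodic⇒periodic (v , y , y-pp , x≡vy) with purelyPeriodic⇒periodic y y-pp
  ... | p , y-periodic = p , recurrentPeriod⇒periodic x ur (suc p) (λ L → length v , factor-≡⁺ x _ _ L (λ {t} _ → tail t))
    where
    V = length v
    tail : ∀ t → x (V + t) ≡ x (V + suc p + t)
    tail t = begin
      x (V + t)                    ≡⟨ x≡vy (V + t) ⟩
      (v ++ω y) (V + t)            ≡⟨ ++ω-shift v y t ⟩
      y t                          ≡⟨ sym (y-periodic t) ⟩
      y (t + suc p)                ≡⟨ sym (++ω-shift v y (t + suc p)) ⟩
      (v ++ω y) (V + (t + suc p))  ≡⟨ sym (x≡vy (V + (t + suc p))) ⟩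
      x (V + (t + suc p))          ≡⟨ cong x (x∙yz≈xz∙y V t (suc p)) ⟩
      x (V + suc p + t)            ∎
      where open ≡-Reasoning

  module _ (dne : DoubleNegationElimination 0ℓ) (aperiodic : Aperiodic x) where

    aperiodic⇒¬periodAt : ∀ p → ∃ λ L → ∀ a → ¬ PeriodAt x (suc p) a L
    aperiodic⇒¬periodAt p = dne λ noWitness →
      aperiodic ([] , x , periodic⇒purelyPeriodic x p
        (recurrentPeriod⇒periodic x ur (suc p) (λ L → dne λ ¬per → noWitness (L , λ a per → ¬per (a , per))))
        , λ _ → refl)

    aperiodic⇒periodFree : ∀ P → ∃ λ L → PeriodFree x P L
    aperiodic⇒periodFree zero    = 0 , λ _ 1≤p p≤0 _ → <⇒≱ 1≤p p≤0
    aperiodic⇒periodFree (suc P) with aperiodic⇒periodFree P | aperiodic⇒¬periodAt P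
    ... | L₁ , free₁ | L₂ , free₂ = L₁ + L₂ , free
      where
      free : PeriodFree x (suc P) (L₁ + L₂)
      free a {p} 1≤p p≤1+P per with m≤n⇒m<n∨m≡n p≤1+P
      ... | inj₁ p≤P = free₁ a 1≤p (s≤s⁻¹ p≤P) (factor-restrict x (m≤m+n L₁ L₂) per)
      ... | inj₂ refl = free₂ a (factor-restrict x (m≤n+m L₂ L₁) per)

-- Counting and lower densities

fraction-toℚᵘ : ∀ a b → ℚ.toℚᵘ ((ℤ.+ a) ℚ./ suc b) ℚᵘ.≃ ℚᵘ.mkℚᵘ (ℤ.+ a) b
fraction-toℚᵘ a b = ℚP.toℚᵘ-fromℚᵘ (ℚᵘ.mkℚᵘ (ℤ.+ a) b)

positive⇒fraction : ∀ {ε} → 0ℚ ℚ.< ε → ∃₂ λ e q → ε ≡ (ℤ.+ suc e) ℚ./ suc q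
positive⇒fraction {ℚ.mkℚ (ℤ.+ zero) _ _}       (ℚ.*<* (ℤ.+<+ ()))
positive⇒fraction {ε@(ℚ.mkℚ ℤ.+[1+ e ] q _)} _ = e , q , sym (ℚP.fromℚᵘ-toℚᵘ ε)
positive⇒fraction {ℚ.mkℚ ℤ.-[1+ _ ] _ _}       (ℚ.*<* ())

0<fraction : ∀ a b → 0ℚ ℚ.< (ℤ.+ suc a) ℚ./ suc b
0<fraction a b = ℚP.toℚᵘ-cancel-<
  (ℚᵘP.<-respʳ-≃ (ℚᵘP.≃-sym (fraction-toℚᵘ (suc a) b)) (ℚᵘ.*<* (ℤ.+<+ (s≤s z≤n))))

private
  [i+j]-j≡i : ∀ (i j : ℤ.ℤ) → (i ℤ.+ j) ℤ.- j ≡ i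
  [i+j]-j≡i = ℤSolver.solve-∀

  [i-j]+j≡i : ∀ (i j : ℤ.ℤ) → (i ℤ.- j) ℤ.+ j ≡ i
  [i-j]+j≡i = ℤSolver.solve-∀

module _ (a b e q c n : ℕ) where

  private
    difference : ℚᵘ.ℚᵘ
    difference = ℚᵘ.mkℚᵘ (ℤ.+ a) b ℚᵘ.- ℚᵘ.mkℚᵘ (ℤ.+ e) q

    toℚᵘ-difference : ℚ.toℚᵘ ((ℤ.+ a) ℚ./ suc b ℚ.- (ℤ.+ e) ℚ./ suc q) ℚᵘ.≃ difference
    toℚᵘ-difference = ℚᵘP.≃-trans (ℚP.toℚᵘ-homo-+ ((ℤ.+ a) ℚ./ suc b) (ℚ.- ((ℤ.+ e) ℚ./ suc q)))
      (ℚᵘP.+-cong (fraction-toℚᵘ a b) (ℚᵘP.≃-trans (ℚP.toℚᵘ-homo‿- ((ℤ.+ e) ℚ./ suc q)) (ℚᵘP.-‿cong (fraction-toℚᵘ e q))))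

    numerator : (ℤ.+ a ℤ.* ℤ.+ suc q ℤ.+ (ℤ.- ℤ.+ e) ℤ.* ℤ.+ suc b) ℤ.* ℤ.+ suc n
              ≡ ℤ.+ (a * suc q * suc n) ℤ.- ℤ.+ (e * suc b * suc n)
    numerator = trans (distribute (ℤ.+ a) (ℤ.+ suc q) (ℤ.+ e) (ℤ.+ suc b) (ℤ.+ suc n))
                      (cong₂ ℤ._-_ (+-*³ a (suc q) (suc n)) (+-*³ e (suc b) (suc n)))
      where
      distribute : ∀ (a q e b n : ℤ.ℤ) → (a ℤ.* q ℤ.+ (ℤ.- e) ℤ.* b) ℤ.* n ≡ a ℤ.* q ℤ.* n ℤ.- e ℤ.* b ℤ.* n
      distribute = ℤSolver.solve-∀
      +-*³ : ∀ x y z → ℤ.+ x ℤ.* ℤ.+ y ℤ.* ℤ.+ z ≡ ℤ.+ (x * y * z)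
      +-*³ x y z = trans (cong (ℤ._* ℤ.+ z) (sym (ℤP.pos-* x y))) (sym (ℤP.pos-* (x * y) z))

    denominator : ℤ.+ c ℤ.* ℤ.+ (suc b * suc q) ≡ ℤ.+ (c * suc b * suc q)
    denominator = trans (sym (ℤP.pos-* c (suc b * suc q))) (cong ℤ.+_ (sym (*-assoc c (suc b) (suc q))))

    x≤z+y⇒x-y≤z : ∀ x y z → x ≤ z + y → ℤ.+ x ℤ.- ℤ.+ y ℤ.≤ ℤ.+ z
    x≤z+y⇒x-y≤z x y z le = ℤP.≤-trans (ℤP.+-monoˡ-≤ (ℤ.- ℤ.+ y) (subst (ℤ.+ x ℤ.≤_) (ℤP.pos-+ z y) (ℤ.+≤+ le)))
                                 (ℤP.≤-reflexive ([i+j]-j≡i (ℤ.+ z) (ℤ.+ y)))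

    x-y≤z⇒x≤z+y : ∀ x y z → ℤ.+ x ℤ.- ℤ.+ y ℤ.≤ ℤ.+ z → x ≤ z + y
    x-y≤z⇒x≤z+y x y z le = ℤP.drop‿+≤+ (ℤP.≤-trans (ℤP.≤-reflexive (sym ([i-j]+j≡i (ℤ.+ x) (ℤ.+ y))))
      (subst ((ℤ.+ x ℤ.- ℤ.+ y) ℤ.+ ℤ.+ y ℤ.≤_) (sym (ℤP.pos-+ z y)) (ℤP.+-monoˡ-≤ (ℤ.+ y) le)))

  cross≤⇒difference≤fraction : a * suc q * suc n ≤ c * suc b * suc q + e * suc b * suc n →
                               (ℤ.+ a) ℚ./ suc b ℚ.- (ℤ.+ e) ℚ./ suc q ℚ.≤ (ℤ.+ c) ℚ./ suc n
  cross≤⇒difference≤fraction le = ℚP.toℚᵘ-cancel-≤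
    (ℚᵘP.≤-respˡ-≃ (ℚᵘP.≃-sym toℚᵘ-difference) (ℚᵘP.≤-respʳ-≃ (ℚᵘP.≃-sym (fraction-toℚᵘ c n))
      (ℚᵘ.*≤* (subst₂ ℤ._≤_ (sym numerator) (sym denominator) (x≤z+y⇒x-y≤z _ _ _ le)))))

  difference≤fraction⇒cross≤ : (ℤ.+ a) ℚ./ suc b ℚ.- (ℤ.+ e) ℚ./ suc q ℚ.≤ (ℤ.+ c) ℚ./ suc n →
                               a * suc q * suc n ≤ c * suc b * suc q + e * suc b * suc n
  difference≤fraction⇒cross≤ le with ℚᵘP.≤-respˡ-≃ toℚᵘ-difference (ℚᵘP.≤-respʳ-≃ (fraction-toℚᵘ c n) (ℚP.toℚᵘ-mono-≤ le))
  ... | ℚᵘ.*≤* le′ = x-y≤z⇒x≤z+y _ _ _ (subst₂ ℤ._≤_ numerator denominator le′)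

BoundedGaps : (ℕ → Set) → ℕ → ℕ → Set
BoundedGaps X N M = ∀ m → M ≤ m → ∃ λ w → m ≤ w × w ≤ m + N × X w

Separated : (ℕ → Set) → ℕ → ℕ → Set
Separated X S L = ∀ {m s} → L ≤ m → 1 ≤ s → s ≤ S → X m → ¬ X (m + s)

module _ {X : ℕ → Set} {N M : ℕ} (gaps : BoundedGaps X N M) (positive : ∀ {w} → X w → 1 ≤ w) (n : ℕ) where

  private
    D = suc N

    collect : ∀ c → M + c * D ≤ suc n →
              Σ (List ℕ) λ l → (Unique l × length l ≡ c × All (λ i → 1 ≤ i × i ≤ n × X i) l) × All (_< M + c * D) l
    collect zero    _     = [] , ([] , refl , []) , []
    collect (suc c) bound
      with collect c (≤-trans (+-monoʳ-≤ M (m≤n+m (c * D) D)) bound) | gaps (M + c * D) (m≤m+n M (c * D))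
    ... | l , (unique , len , members) , below | w , lo , hi , Xw =
      w ∷ l , ( All.map (λ i<lo w≡i → <⇒≢ (<-≤-trans i<lo lo) (sym w≡i)) below ∷ unique
              , cong suc len
              , (positive Xw , s≤s⁻¹ (≤-trans w<next bound) , Xw) ∷ members )
            , w<next ∷ All.map (λ i<lo → <-trans i<lo (≤-<-trans lo w<next)) below
      where
      rearrange : ∀ a b c → suc (a + b + c) ≡ a + (suc c + b)
      rearrange = solve-∀
      w<next : w < M + suc c * D
      w<next = ≤-trans (s≤s hi) (≤-reflexive (rearrange M (c * D) N))

  boundedGaps⇒linearCount : M ≤ n → ∃ λ c → CountAtLeast X n c × n < c * D + (D + M)
  boundedGaps⇒linearCount M≤n = c , map₂ proj₁ (collect c bound) , n<
    where
    R = suc n ∸ M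
    c = R / D
    M≤1+n : M ≤ suc n
    M≤1+n = ≤-trans M≤n (n≤1+n n)
    bound : M + c * D ≤ suc n
    bound = ≤-trans (+-monoʳ-≤ M (m/n*n≤m R D)) (≤-reflexive (m+[n∸m]≡n M≤1+n))
    rearrange : ∀ a b c → a + b + c ≡ b + (a + c)
    rearrange = solve-∀
    n< : suc n ≤ c * D + (D + M)
    n< = <⇒≤ (begin-strict
      suc n              ≡⟨ sym (m∸n+n≡m M≤1+n) ⟩
      R + M              ≡⟨ cong (_+ M) (m≡m%n+[m/n]*n R D) ⟩
      R % D + c * D + M  <⟨ +-monoˡ-< M (+-monoˡ-< (c * D) (m%n<n R D)) ⟩
      D + c * D + M      ≡⟨ rearrange D (c * D) M ⟩
      c * D + (D + M)    ∎)
      where open ≤-Reasoning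

module _ {X : ℕ → Set} where

  linearCount⇒lowerDensity : ∀ D K a b → a * suc D ≤ suc b →
    (∀ n → K ≤ n → ∃ λ c → CountAtLeast X n c × n ≤ c * suc D + K) →
    LowerDensity≥ X ((ℤ.+ a) ℚ./ suc b)
  linearCount⇒lowerDensity D K a b aD≤b linear ε 0<ε with positive⇒fraction 0<ε
  ... | e , q , refl = K * suc q , dense
    where
    dense : ∀ n → K * suc q ≤ suc n → ∃ λ c → CountAtLeast X (suc n) c ×
            ((ℤ.+ a) ℚ./ suc b ℚ.- (ℤ.+ suc e) ℚ./ suc q) ℚ.≤ (ℤ.+ c) ℚ./ suc n
    dense n Kq≤n′ with linear (suc n) (≤-trans (m≤m*n K (suc q)) Kq≤n′)
    ... | c , count , n′≤ = c , count , cross≤⇒difference≤fraction a b (suc e) q c n (*-cancelˡ-≤ D′ cleared)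
      where
      D′ = suc D
      n′ = suc n
      rearrange₁ : ∀ a q n D → D * (a * q * n) ≡ a * D * (q * n)
      rearrange₁ = solve-∀
      rearrange₂ : ∀ b q c D K → b * (q * (c * D + K)) ≡ D * (c * b * q) + K * q * b
      rearrange₂ = solve-∀
      rearrange₃ : ∀ D c b q E n → D * (c * b * q) + D * E * n * b ≡ D * (c * b * q + E * b * n)
      rearrange₃ = solve-∀
      cleared : D′ * (a * suc q * n′) ≤ D′ * (c * suc b * suc q + suc e * suc b * n′)
      cleared = begin
        D′ * (a * suc q * n′)                          ≡⟨ rearrange₁ a (suc q) n′ D′ ⟩
        a * D′ * (suc q * n′)                          ≤⟨ *-monoˡ-≤ (suc q * n′) aD≤b ⟩
        suc b * (suc q * n′)                           ≤⟨ *-monoʳ-≤ (suc b) (*-monoʳ-≤ (suc q) n′≤) ⟩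
        suc b * (suc q * (c * D′ + K))                 ≡⟨ rearrange₂ (suc b) (suc q) c D′ K ⟩
        D′ * (c * suc b * suc q) + K * suc q * suc b   ≤⟨ +-monoʳ-≤ (D′ * (c * suc b * suc q))
                                                           (*-monoˡ-≤ (suc b) (≤-trans Kq≤n′ (m≤n*m n′ (D′ * suc e)))) ⟩
        D′ * (c * suc b * suc q) + D′ * suc e * n′ * suc b ≡⟨ rearrange₃ D′ c (suc b) (suc q) (suc e) n′ ⟩
        D′ * (c * suc b * suc q + suc e * suc b * n′)  ∎
        where open ≤-Reasoning

  boundedGaps⇒lowerDensity : ∀ {N M} → BoundedGaps X N M → (∀ {w} → X w → 1 ≤ w) →
                             ∀ a b → a * suc N ≤ suc b → LowerDensity≥ X ((ℤ.+ a) ℚ./ suc b)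
  boundedGaps⇒lowerDensity {N} {M} gaps positive a b aN≤b =
    linearCount⇒lowerDensity N (suc N + M) a b aN≤b λ n K≤n →
      map₂ (map₂ <⇒≤) (boundedGaps⇒linearCount gaps positive n (≤-trans (m≤n+m M (suc N)) K≤n))

  -- With ε = 1/(2(b + 1)) ≤ r/2 the density bound leaves at least n/(2(b + 1)) elements below n.
  lowerDensity⇒linearCount : ∀ {r} → LowerDensity≥ X r → 0ℚ ℚ.< r →
    ∃₂ λ D N → ∀ n → N ≤ suc n → ∃ λ c → CountAtLeast X (suc n) c × suc n ≤ c * suc D
  lowerDensity⇒linearCount density 0<r with positive⇒fraction 0<r
  ... | a , b , refl = D , proj₁ (density ε 0<ε) , linear
    where
    D = b + suc b
    ε = (ℤ.+ 1) ℚ./ suc D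
    0<ε = 0<fraction 0 D
    linear : ∀ n → proj₁ (density ε 0<ε) ≤ suc n → ∃ λ c → CountAtLeast X (suc n) c × suc n ≤ c * suc D
    linear n N≤ with proj₂ (density ε 0<ε) n N≤
    ... | c , count , r-ε≤ = c , count , halve (difference≤fraction⇒cross≤ (suc a) b 1 D c n r-ε≤)
      where
      n′ = suc n
      rearrange₁ : ∀ b n → b * n + b * n ≡ (b + b) * n
      rearrange₁ = solve-∀
      rearrange₂ : ∀ c b n → c * b * (b + b) + 1 * b * n ≡ b * (c * (b + b)) + b * n
      rearrange₂ = solve-∀
      halve : suc a * suc D * n′ ≤ c * suc b * suc D + 1 * suc b * n′ → n′ ≤ c * suc D
      halve le = *-cancelˡ-≤ (suc b) (+-cancelʳ-≤ (suc b * n′) (suc b * n′) (suc b * (c * suc D)) (begin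
        suc b * n′ + suc b * n′            ≡⟨ rearrange₁ (suc b) n′ ⟩
        suc D * n′                         ≤⟨ *-monoˡ-≤ n′ (m≤n*m (suc D) (suc a)) ⟩
        suc a * suc D * n′                 ≤⟨ le ⟩
        c * suc b * suc D + 1 * suc b * n′ ≡⟨ rearrange₂ c (suc b) n′ ⟩
        suc b * (c * suc D) + suc b * n′   ∎))
        where open ≤-Reasoning

unique⇒lookup-≢ : ∀ {B : Set} (l : List B) → Unique l → ∀ {i j} → i Fin.< j → lookup l i ≢ lookup l j
unique⇒lookup-≢ (a ∷ l) (a≢ ∷ _)      {Fin.zero}  {Fin.suc j} _         = All.lookup a≢ (∈-lookup j)
unique⇒lookup-≢ (a ∷ l) (_  ∷ unique) {Fin.suc i} {Fin.suc j} (s≤s i<j) = unique⇒lookup-≢ l unique i<j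

pigeonhole-length≤ : ∀ {P : ℕ → Set} {K} (f : ℕ → ℕ) (l : List ℕ) → Unique l →
                     All (λ i → P i × f i < K) l → (∀ {i j} → P i → P j → i ≢ j → f i ≢ f j) → length l ≤ K
pigeonhole-length≤ {P} {K} f l unique members injective with length l ≤? K
... | yes ≤K = ≤K
... | no  ≰K = ⊥-elim (collision (pigeonhole (≰⇒> ≰K) (λ i → fromℕ< (proj₂ (member i)))))
  where
  member : ∀ i → P (lookup l i) × f (lookup l i) < K
  member i = All.lookup members (∈-lookup i)
  collision : ¬ ∃₂ λ i j → i Fin.< j × fromℕ< (proj₂ (member i)) ≡ fromℕ< (proj₂ (member j))
  collision (i , j , i<j , same) =
    injective (proj₁ (member i)) (proj₁ (member j)) (unique⇒lookup-≢ l unique i<j)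
              (trans (sym (toℕ-fromℕ< _)) (trans (cong toℕ same) (toℕ-fromℕ< _)))

-- Past L the elements of X are more than S apart, so each interval [L + t(S + 1), L + (t + 1)(S + 1))
-- contains at most one of them.
module _ {X : ℕ → Set} {S L : ℕ} (separated : Separated X S L) where

  private
    bucket : ℕ → ℕ
    bucket e with e <? L
    ... | yes _ = e
    ... | no  _ = L + (e ∸ L) / suc S

    bucket< : ∀ {n e} → e ≤ n → bucket e < suc (L + n / suc S)
    bucket< {n} {e} e≤n with e <? L
    ... | yes e<L = s≤s (≤-trans (<⇒≤ e<L) (m≤m+n L _))
    ... | no  _   = s≤s (+-monoʳ-≤ L (/-monoˡ-≤ (suc S) (≤-trans (m∸n≤m e L) e≤n)))

    sameBucket⇒near : ∀ {e e′} → L ≤ e → L ≤ e′ → (e ∸ L) / suc S ≡ (e′ ∸ L) / suc S → e′ ≤ e + S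
    sameBucket⇒near {e} {e′} L≤e L≤e′ same = begin
      e′                                       ≡⟨ sym (m+[n∸m]≡n L≤e′) ⟩
      L + (e′ ∸ L)                             ≡⟨ cong (L +_) (m≡m%n+[m/n]*n (e′ ∸ L) (suc S)) ⟩
      L + ((e′ ∸ L) % suc S + q′ * suc S)      ≤⟨ +-monoʳ-≤ L (+-monoˡ-≤ _ (s≤s⁻¹ (m%n<n (e′ ∸ L) (suc S)))) ⟩
      L + (S + q′ * suc S)                     ≡⟨ cong (λ z → L + (S + z * suc S)) (sym same) ⟩
      L + (S + (e ∸ L) / suc S * suc S)        ≤⟨ +-monoʳ-≤ L (+-monoʳ-≤ S (m/n*n≤m (e ∸ L) (suc S))) ⟩
      L + (S + (e ∸ L))                        ≡⟨ x∙yz≈xz∙y L S (e ∸ L) ⟩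
      L + (e ∸ L) + S                          ≡⟨ cong (_+ S) (m+[n∸m]≡n L≤e) ⟩
      e + S                                    ∎
      where
      open ≤-Reasoning
      q′ = (e′ ∸ L) / suc S

    bucket-injective-< : ∀ {e e′} → e < e′ → X e → X e′ → bucket e ≢ bucket e′
    bucket-injective-< {e} {e′} e<e′ Xe Xe′ same with e <? L | e′ <? L
    ... | yes _   | yes _    = <⇒≢ e<e′ same
    ... | yes e<L | no  _    = <⇒≢ (≤-trans e<L (m≤m+n L _)) same
    ... | no  _   | yes e′<L = <⇒≢ (≤-trans e′<L (m≤m+n L _)) (sym same)
    ... | no  e≮L | no  e′≮L =
      separated L≤e (m<n⇒0<n∸m e<e′) (m≤n+o⇒m∸n≤o e′ e (sameBucket⇒near L≤e (≮⇒≥ e′≮L) (+-cancelˡ-≡ L _ _ same)))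
                Xe (subst X (sym (m+[n∸m]≡n (<⇒≤ e<e′))) Xe′)
      where L≤e = ≮⇒≥ e≮L

    bucket-injective : ∀ {e e′} → X e → X e′ → e ≢ e′ → bucket e ≢ bucket e′
    bucket-injective {e} {e′} Xe Xe′ e≢e′ with <-cmp e e′
    ... | tri< e<e′ _ _ = bucket-injective-< e<e′ Xe Xe′
    ... | tri≈ _ e≡e′ _ = ⊥-elim (e≢e′ e≡e′)
    ... | tri> _ _ e′<e = bucket-injective-< e′<e Xe′ Xe ∘ sym

  separated⇒count≤ : ∀ n c → CountAtLeast X n c → c ≤ suc (L + n / suc S)
  separated⇒count≤ n c (l , unique , refl , members) =
    pigeonhole-length≤ bucket l unique (All.map (λ (_ , e≤n , Xe) → Xe , bucket< e≤n) members) bucket-injective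

-- Powers and anti-powers

-- triangle k = k(k − 1)/2 counts the pairs i < j < k, and pairIndex numbers them from 0.
triangle : ℕ → ℕ
triangle zero    = 0
triangle (suc j) = triangle j + j

pairIndex : ℕ → ℕ → ℕ
pairIndex i j = triangle j + i

triangle-mono-≤ : ∀ {j j′} → j ≤ j′ → triangle j ≤ triangle j′
triangle-mono-≤ {j′ = zero}   z≤n = ≤-refl
triangle-mono-≤ {j′ = suc j′} j≤1+j′ with m≤n⇒m<n∨m≡n j≤1+j′
... | inj₁ j≤j′ = ≤-trans (triangle-mono-≤ (s≤s⁻¹ j≤j′)) (m≤m+n (triangle j′) j′)
... | inj₂ refl = ≤-refl

2*triangle : ∀ k → 2 * triangle k ≡ k * (k ∸ 1)
2*triangle zero          = refl
2*triangle (suc zero)    = refl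
2*triangle (suc (suc k)) = begin
  2 * (triangle (suc k) + suc k)    ≡⟨ *-distribˡ-+ 2 (triangle (suc k)) (suc k) ⟩
  2 * triangle (suc k) + 2 * suc k  ≡⟨ cong (_+ 2 * suc k) (2*triangle (suc k)) ⟩
  suc k * k + 2 * suc k             ≡⟨ rearrange k ⟩
  suc (suc k) * suc k               ∎
  where
  open ≡-Reasoning
  rearrange : ∀ k → suc k * k + 2 * suc k ≡ suc (suc k) * suc k
  rearrange = solve-∀

pairIndex< : ∀ {i j k} → i < j → j < k → pairIndex i j < triangle k
pairIndex< {i} {j} i<j j<k = ≤-trans (+-monoʳ-< (triangle j) i<j) (triangle-mono-≤ j<k)

pairIndex-injective : ∀ {i j i′ j′} → i < j → i′ < j′ → pairIndex i j ≡ pairIndex i′ j′ → i ≡ i′ × j ≡ j′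
pairIndex-injective {i} {j} {i′} {j′} i<j i′<j′ same with <-cmp j j′
... | tri< j<j′ _ _ = ⊥-elim (<⇒≢ (≤-trans (pairIndex< i<j j<j′) (m≤m+n (triangle j′) i′)) same)
... | tri> _ _ j′<j = ⊥-elim (<⇒≢ (≤-trans (pairIndex< i′<j′ j′<j) (m≤m+n (triangle j) i)) (sym same))
... | tri≈ _ refl _ = +-cancelˡ-≡ (triangle j) i i′ same , refl

module _ {A : Set} (x : Word A) where

  block : ℕ → ℕ → List A
  block m i = factor x (i * m) m

  concat≡prefix⇒blocks : ∀ {k m ℓ} (us : List (List A)) → length us ≡ suc k → All (λ u → length u ≡ ℓ) us →
                         concat us ≡ prefix (suc k * m) x → us ≡ applyUpTo (block m) (suc k)
  concat≡prefix⇒blocks {k} {m} {ℓ} us len lengths eq =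
    subst (λ n → us ≡ applyUpTo (block m) n) len
      (concat≡factor⇒blocks x 0 m us (subst (λ ℓ → All (λ u → length u ≡ ℓ) us) ℓ≡m lengths)
                                     (subst (λ n → concat us ≡ prefix (n * m) x) (sym len) eq))
    where
    open ≡-Reasoning
    ℓ≡m : ℓ ≡ m
    ℓ≡m = *-cancelˡ-≡ ℓ m (suc k) (begin
      suc k * ℓ                     ≡⟨ cong (_* ℓ) (sym len) ⟩
      length us * ℓ                 ≡⟨ sym (length-concat-uniform ℓ us lengths) ⟩
      length (concat us)            ≡⟨ cong length eq ⟩
      length (prefix (suc k * m) x) ≡⟨ length-factor x 0 (suc k * m) ⟩
      suc k * m                     ∎)

  square⇒periodAt : ∀ {m} → P x 2 m → PeriodAt x m 0 m
  square⇒periodAt {m} (_ , u , _ , eq) with concat≡prefix⇒blocks (replicate 2 u) refl (refl ∷ refl ∷ []) (sym eq)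
  ... | uu≡blocks = trans (sym (∷-injectiveˡ uu≡blocks))
                      (trans (∷-injectiveˡ (∷-injectiveʳ uu≡blocks)) (cong (λ i → factor x i m) (+-identityʳ m)))

  squares⇒periodAt : ∀ {m s L} → L ≤ m → P x 2 m → P x 2 (m + s) → PeriodAt x s m L
  squares⇒periodAt {m} {s} L≤m square square′ =
    trans (sym (factor-restrict x L≤m (square⇒periodAt square)))
          (factor-restrict x (≤-trans L≤m (m≤m+n m s)) (square⇒periodAt square′))

  antiPower⇒uniqueBlocks : ∀ {k m} → AP x (suc k) m → Unique (applyUpTo (block m) (suc k))
  antiPower⇒uniqueBlocks (_ , us , _ , len , _ , lengths , unique , eq) =
    subst Unique (concat≡prefix⇒blocks us len lengths (sym eq)) unique

  distinctBlocks⇒antiPower : ∀ {k m} → 1 ≤ m → (∀ {i j} → i < j → j < k → block m i ≢ block m j) → AP x k m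
  distinctBlocks⇒antiPower {k} {m} 1≤m distinct =
    1≤m , applyUpTo (block m) k , m , length-applyUpTo _ k ,
    applyUpTo⁺₁ _ k (λ _ empty → <⇒≢ 1≤m (trans (sym (cong length empty)) (length-factor x _ m))) ,
    applyUpTo⁺₁ _ k (λ _ → length-factor x _ m) ,
    Unique.applyUpTo⁺₁ _ k distinct ,
    sym (concat-blocks x 0 m k)

  periodic⇒¬antiPower : ∀ {p m} → Periodic x (suc p) → ¬ AP x (suc (suc p)) m
  periodic⇒¬antiPower {p} {m} periodic ap with antiPower⇒uniqueBlocks ap
  ... | block₀-fresh ∷ _ = applyUpTo⁻ (block m ∘ suc) (suc p) block₀-fresh {p} ≤-refl (sym shifted)
    where
    shifted : block m (suc p) ≡ block m 0
    shifted = factor-≡⁺ x (suc p * m) 0 m λ {t} _ →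
      trans (cong x (trans (+-comm (suc p * m) t) (cong (t +_) (*-comm (suc p) m)))) (periodic-* x periodic m t)

  RepeatedBlock : ℕ → ℕ → Set
  RepeatedBlock k m = ∃₂ λ i d → 1 ≤ d × i + d < k × block m i ≡ block m (i + d)

  ¬antiPower⇒repeatedBlock : DoubleNegationElimination 0ℓ → ∀ {k m} → 1 ≤ m → ¬ AP x k m → RepeatedBlock k m
  ¬antiPower⇒repeatedBlock dne {k} {m} 1≤m ¬ap = dne λ noRepeat → ¬ap (distinctBlocks⇒antiPower 1≤m
    λ {i} {j} i<j j<k same → let i+[j∸i]≡j = m+[n∸m]≡n (<⇒≤ i<j) in
      noRepeat (i , j ∸ i , m<n⇒0<n∸m i<j , subst (_< k) (sym i+[j∸i]≡j) j<k ,
                subst (λ z → block m i ≡ block m z) (sym i+[j∸i]≡j) same))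

  repeatedBlocks⇒periodAt : ∀ {i d m s L} → i * s + L ≤ m → block m i ≡ block m (i + d) →
                            block (m + s) i ≡ block (m + s) (i + d) → PeriodAt x (d * s) ((i + d) * m + i * s) L
  repeatedBlocks⇒periodAt {i} {d} {m} {s} {L} le same same′ = begin
    factor x ((i + d) * m + i * s) L          ≡⟨ sym (factor-shift x (i * s) le same) ⟩
    factor x (i * m + i * s) L                ≡⟨ cong (λ z → factor x z L) (sym (*-distribˡ-+ i m s)) ⟩
    factor x (i * (m + s)) L                  ≡⟨ factor-restrict x (≤-trans (m≤n+m L (i * s)) (≤-trans le (m≤m+n m s))) same′ ⟩
    factor x ((i + d) * (m + s)) L            ≡⟨ cong (λ z → factor x z L) (expand i d m s) ⟩
    factor x ((i + d) * m + i * s + d * s) L  ∎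
    where
    open ≡-Reasoning
    expand : ∀ i d m s → (i + d) * (m + s) ≡ (i + d) * m + i * s + d * s
    expand = solve-∀

  block-cong : ∀ {m m′ i i′ j j′} → m ≡ m′ → i ≡ i′ → j ≡ j′ → block m i ≡ block m j → block m′ i′ ≡ block m′ j′
  block-cong refl refl refl same = same

module _ {A : Set} {x : Word A} (dne : DoubleNegationElimination 0ℓ) (ur : UniformlyRecurrent x)
         (aperiodic : Aperiodic x) (k : ℕ) where

  private
    N = triangle k
    L = proj₁ (aperiodic⇒periodFree ur dne aperiodic (k * N))
    free : PeriodFree x (k * N) L
    free = proj₂ (aperiodic⇒periodFree ur dne aperiodic (k * N))
    M = suc (k * N + L)

    repeatIndex : ∀ {m} → RepeatedBlock x k m → Fin N
    repeatIndex (i , d , 1≤d , i+d<k , _) = fromℕ< (pairIndex< (m<m+n i 1≤d) i+d<k)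

    sameIndex⇒⊥ : ∀ {m₁ m₂} (rb₁ : RepeatedBlock x k m₁) (rb₂ : RepeatedBlock x k m₂) →
                  repeatIndex rb₁ ≡ repeatIndex rb₂ → M ≤ m₁ → m₁ < m₂ → m₂ ≤ m₁ + N → ⊥
    sameIndex⇒⊥ {m₁} {m₂} (i , d , 1≤d , i+d<k , same) (i′ , d′ , 1≤d′ , _ , same′) sameIndex M≤m₁ m₁<m₂ m₂≤m₁+N
      with pairIndex-injective (m<m+n i 1≤d) (m<m+n i′ 1≤d′)
             (trans (sym (toℕ-fromℕ< _)) (trans (cong toℕ sameIndex) (toℕ-fromℕ< _)))
    ... | i≡i′ , j≡j′ = free ((i + d) * m₁ + i * s) (*-mono-≤ 1≤d 1≤s) (*-mono-≤ d≤k s≤N)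
          (repeatedBlocks⇒periodAt x {i} {d} {m₁} {s} {L} offset≤m₁ same
            (block-cong x (sym (m+[n∸m]≡n (<⇒≤ m₁<m₂))) (sym i≡i′) (sym j≡j′) same′))
      where
      s = m₂ ∸ m₁
      1≤s : 1 ≤ s
      1≤s = m<n⇒0<n∸m m₁<m₂
      s≤N : s ≤ N
      s≤N = m≤n+o⇒m∸n≤o m₂ m₁ m₂≤m₁+N
      d≤k : d ≤ k
      d≤k = ≤-trans (m≤n+m d i) (<⇒≤ i+d<k)
      i≤k : i ≤ k
      i≤k = ≤-trans (m≤m+n i d) (<⇒≤ i+d<k)
      offset≤m₁ : i * s + L ≤ m₁
      offset≤m₁ = ≤-trans (+-monoˡ-≤ L (*-mono-≤ i≤k s≤N))
                          (≤-trans (n≤1+n _) M≤m₁)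

  -- If none of m, …, m + N were an anti-power exponent, each would have a pair of equal blocks; by
  -- pigeonhole two of them, m₁ < m₂, share the pair (i, i + d), and then the factor of length L at
  -- (i + d)m₁ + i(m₂ − m₁) has the period d(m₂ − m₁) ≤ kN.
  antiPowers-boundedGaps : ∃ λ M → BoundedGaps (AP x k) (triangle k) M
  antiPowers-boundedGaps = M , window
    where
    window : BoundedGaps (AP x k) N M
    window m M≤m = dne λ none →
      let repeated : (r : Fin (suc N)) → RepeatedBlock x k (m + toℕ r)
          repeated r = ¬antiPower⇒repeatedBlock x dne (≤-trans (s≤s z≤n) (≤-trans M≤m (m≤m+n m _)))
                         λ ap → none (m + toℕ r , m≤m+n m _ , +-monoʳ-≤ m (toℕ≤pred[n] r) , ap)
          r₁ , r₂ , r₁<r₂ , sameIndex = pigeonhole (n<1+n N) (repeatIndex ∘ repeated)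
      in sameIndex⇒⊥ (repeated r₁) (repeated r₂) sameIndex (≤-trans M≤m (m≤m+n m _)) (+-monoʳ-< m r₁<r₂)
                     (≤-trans (+-monoʳ-≤ m (toℕ≤pred[n] r₂)) (+-monoˡ-≤ N (m≤m+n m _)))

m≤[1+m/n]*n : ∀ m n .{{_ : NonZero n}} → m ≤ suc (m / n) * n
m≤[1+m/n]*n m n = <⇒≤ (begin-strict
  m                  ≡⟨ m≡m%n+[m/n]*n m n ⟩
  m % n + m / n * n  <⟨ +-monoˡ-< (m / n * n) (m%n<n m n) ⟩
  n + m / n * n      ∎)
  where open ≤-Reasoning

[1+m/n]*n≤m+n : ∀ m n .{{_ : NonZero n}} → suc (m / n) * n ≤ m + n
[1+m/n]*n≤m+n m n = ≤-trans (+-monoʳ-≤ n (m/n*n≤m m n)) (≤-reflexive (+-comm n m))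

0<antiPowerBound : ∀ k → 0ℚ ℚ.< antiPowerBound k
0<antiPowerBound k = 0<fraction 1 (suc (k * (k ∸ 1)))

n≤cD∧c≤1+L+n/[1+2D]⇒n≤2D[1+L] : ∀ {n c D L} → n ≤ c * D → c ≤ suc (L + n / suc (2 * D)) → n ≤ 2 * D * suc L
n≤cD∧c≤1+L+n/[1+2D]⇒n≤2D[1+L] {n} {c} {D} {L} n≤cD c≤ = +-cancelʳ-≤ n n (2 * D * suc L) (begin
  n + n                        ≤⟨ +-mono-≤ n≤cD n≤cD ⟩
  c * D + c * D                ≡⟨ double c D ⟩
  c * (2 * D)                  ≤⟨ *-monoˡ-≤ (2 * D) c≤ ⟩
  suc (L + W) * (2 * D)        ≡⟨ expand L W D ⟩
  2 * D * suc L + W * (2 * D)  ≤⟨ +-monoʳ-≤ (2 * D * suc L) (≤-trans (*-monoʳ-≤ W (n≤1+n (2 * D))) (m/n*n≤m n (suc (2 * D)))) ⟩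
  2 * D * suc L + n            ∎)
  where
  open ≤-Reasoning
  W = n / suc (2 * D)
  double : ∀ c D → c * D + c * D ≡ c * (2 * D)
  double = solve-∀
  expand : ∀ L W D → suc (L + W) * (2 * D) ≡ 2 * D * suc L + W * (2 * D)
  expand = solve-∀

module _ {A : Set} {x : Word A} where

  aperiodic⇒cond1 : DoubleNegationElimination 0ℓ → UniformlyRecurrent x → Aperiodic x → Cond1 x
  aperiodic⇒cond1 dne ur aperiodic k _ =
    boundedGaps⇒lowerDensity (proj₂ (antiPowers-boundedGaps dne ur aperiodic k)) proj₁ 2 (suc (k * (k ∸ 1)))
      (≤-reflexive (trans (*-suc 2 (triangle k)) (cong (2 +_) (2*triangle k))))

  -- Squares have gaps larger than 2(D + 1) past L, which caps their count below n near n/(2(D + 1)),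
  -- against the n/(D + 1) that a positive lower density provides.
  aperiodic⇒¬cond2 : DoubleNegationElimination 0ℓ → UniformlyRecurrent x → Aperiodic x → ¬ Cond2 x
  aperiodic⇒¬cond2 dne ur aperiodic (r , 0<r , density) with lowerDensity⇒linearCount (density 2 (s≤s z≤n)) 0<r
  ... | D , N , linear with aperiodic⇒periodFree ur dne aperiodic (2 * suc D)
  ... | L , free with linear (N + 2 * suc D * suc L) (≤-trans (m≤m+n N _) (n≤1+n _))
  ... | c , count , n≤cD = <⇒≱ (s≤s (m≤n+m _ N))
          (n≤cD∧c≤1+L+n/[1+2D]⇒n≤2D[1+L] n≤cD (separated⇒count≤ squaresSeparated _ c count))
    where
    squaresSeparated : Separated (P x 2) (2 * suc D) L
    squaresSeparated L≤m 1≤s s≤S square square′ = free _ 1≤s s≤S (squares⇒periodAt x L≤m square square′)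

  module _ {p : ℕ} (periodic : Periodic x (suc p)) where

    powers-boundedGaps : ∀ k → BoundedGaps (P x k) (suc p) 1
    powers-boundedGaps k m _ = w , m≤[1+m/n]*n m (suc p) , [1+m/n]*n≤m+n m (suc p) , s≤s z≤n ,
      prefix w x , (λ ()) , periodic⇒prefixPower x (periodic-* x periodic (suc (m / suc p))) k
      where w = suc (m / suc p) * suc p

    periodic⇒cond2 : Cond2 x
    periodic⇒cond2 = (ℤ.+ 1) ℚ./ suc (suc p) , 0<fraction 0 (suc p) , λ k _ →
      boundedGaps⇒lowerDensity (powers-boundedGaps k) proj₁ 1 (suc p) (≤-reflexive (*-identityˡ _))

    periodic⇒¬cond1 : ¬ Cond1 x
    periodic⇒¬cond1 cond1 with lowerDensity⇒linearCount (cond1 (suc (suc p)) (s≤s z≤n)) (0<antiPowerBound (suc (suc p)))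
    ... | D , N , linear with linear N (n≤1+n N)
    ... | c , (w ∷ _ , _ , _ , (_ , _ , antiPower) ∷ _) , _ = periodic⇒¬antiPower x periodic antiPower
    ... | c , ([] , _ , refl , []) , ()

corollary5 : ExcludedMiddle 0ℓ → {A : Set} → (x : Word A) → UniformlyRecurrent x →
    ((Cond1 x × Aperiodic x) ⊎ (Cond2 x × PurelyPeriodic x)) × ¬ (Cond1 x × Cond2 x)
corollary5 em x ur with em {UltimatelyPeriodic x}
... | no aperiodic =
  inj₁ (aperiodic⇒cond1 (em⇒dne em) ur aperiodic , aperiodic) , aperiodic⇒¬cond2 (em⇒dne em) ur aperiodic ∘ proj₂
... | yes ultimatelyPeriodic with ultimatelyPeriodic⇒periodic ur ultimatelyPeriodic
... | p , periodic =
  inj₂ (periodic⇒cond2 periodic , periodic⇒purelyPeriodic x p periodic) , periodic⇒¬cond1 periodic ∘ proj₁
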